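{- Let $n\ge 2$. Then \[ \sum_{k=1}^{n}[k]_q\,q^{k-1}\,\frac{[k+1]_q\,[k]_q}{1+q}\;=\;\sum_{(a,b,c,d)\in B,\ c\ge d} q^{(a-1)+(b-2)+(c-1)+(d-1)}, \] where the sum on the right runs over the location labels $(a,b,c,d)$ of the unit cubes of block $B$ with $c\ge d$. The exponent of $q$ on the right side is the taxicab ($\ell^1$) distance between the label $(a,b,c,d)$ and $(1,2,1,1)$.
   Context: $[k]_q=1+q+\cdots+q^{k-1}$ for non-negative integers $k$. For fixed $n\ge 2$, block $B$ is the union of the unit cubes $\{(x,y,z,w): a-1\le x\le a,\ b-1\le y\le b,\ c-1\le z\le c,\ d-1\le w\le d\}$ whose location labels $(a,b,c,d)$ lie in $\{(x,y,z,w)\in\mathbb{Z}^4: 1\le i\le n,\ y=i+1,\ x,z,w\in\{1,\dots,i\}\}$. -}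

module Defs where

open import Data.Nat using (ℕ; zero; suc; _+_; _*_; _∸_; _^_; _≤ᵇ_)
open import Data.Nat.DivMod using (_/_)
open import Data.List using (List; []; _∷_; map; upTo; concatMap; filterᵇ)
open import Data.Nat.ListAction using (sum)
open import Data.Product using (_×_; _,_)

[_]_ : ℕ → ℕ → ℕ
[ k ] q = sum (map (q ^_) (upTo k))

range1 : ℕ → List ℕ
range1 i = map suc (upTo i)

Label : Set
Label = ℕ × ℕ × ℕ × ℕ

blockB : ℕ → List Label
blockB n =
  concatMap (λ i →
    concatMap (λ a →
      concatMap (λ c →
        map (λ d → (a , suc i , c , d)) (range1 i))
      (range1 i))
    (range1 i))
  (range1 n)

blockB-c≥d : ℕ → List Label
blockB-c≥d n = filterᵇ (λ { (a , b , c , d) → d ≤ᵇ c }) (blockB n)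

-- taxicab distance from (a,b,c,d) to (1,2,1,1) (all labels satisfy a,c,d ≥ 1, b ≥ 2)
dist : Label → ℕ
dist (a , b , c , d) = (a ∸ 1) + (b ∸ 2) + (c ∸ 1) + (d ∸ 1)

-- left-hand side, evaluated at q : ℕ;
-- [k+1]_q [k]_q is divisible by 1+q, so the ℕ-division is exact
lhs : ℕ → ℕ → ℕ
lhs n q = sum (map (λ k → [ k ] q * q ^ (k ∸ 1) * (([ suc k ] q * [ k ] q) / suc q)) (range1 n))

rhs : ℕ → ℕ → ℕ
rhs n q = sum (map (λ l → q ^ dist l) (blockB-c≥d n))

{-# OPTIONS --safe #-}

-- Slice B by b = i + 1. In a slice a, c, d run over 1..i, and the condition c ≥ d leaves a prism:
-- a free coordinate a times the triangle d ≤ c ≤ i. Its generating function is therefore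
-- [i]_q q^(i-1) T_i, where T_i = ∑_{1 ≤ d ≤ c ≤ i} q^((c-1)+(d-1)). Adding the row c = i + 1 to T_i
-- adds q^i [i+1]_q, and (1 + q) q^i [i+1]_q = [i+1]_q ([i+2]_q - [i]_q); so (1 + q) T_i = [i+1]_q [i]_q
-- by induction on i, and T_i is the exact quotient on the left-hand side.

module Submission where

open import Defs
open import Data.Nat using (ℕ; _≤_)
open import Relation.Binary.PropositionalEquality using (_≡_)

open import Data.Bool using (Bool; true; false; T)
open import Data.List using (List; []; _∷_; _++_; map; concat; concatMap; filter; filterᵇ; upTo)
open import Data.List.Properties
  using (map-++; map-∘; map-cong; map-cong-local; concatMap-cong; upTo-∷ʳ; filter-++; filter-all; filter-reject; ++-identityʳ)
open import Data.List.Relation.Unary.All as All using (All)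
open import Data.List.Relation.Unary.All.Properties using (all-upTo; map⁺)
open import Data.Nat using (suc; _+_; _*_; _^_; _≤ᵇ_; _≤′_; ≤′-refl; ≤′-step; s≤s)
open import Data.Nat.DivMod using (_/_; m*n/n≡m)
open import Data.Nat.ListAction using (sum)
open import Data.Nat.ListAction.Properties using (sum-++)
open import Data.Nat.Properties
  using (+-assoc; +-identityʳ; *-assoc; *-comm; *-zeroʳ; *-distribˡ-+; ^-distribˡ-+-*; <⇒≱; ≤ᵇ⇒≤; ≤⇒≤ᵇ; ≤′⇒≤; ≤⇒≤′)
open import Data.Nat.Solver using (module +-*-Solver)
open import Data.Product using (_,_)
open import Function using (_∘_)
open import Level using (Level)
open import Relation.Binary.PropositionalEquality using (refl; sym; trans; cong; cong₂; _≗_; module ≡-Reasoning)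
open import Relation.Nullary using (¬_)
open import Relation.Nullary.Decidable using (T?; does)
open import Relation.Unary using (Pred; Decidable)

private
  variable
    A B : Set

∑ : List A → (A → ℕ) → ℕ
∑ xs f = sum (map f xs)

infix 5 ∑
syntax ∑ xs (λ x → e) = ∑[ x ← xs ] e

∑-++ : ∀ xs ys (f : A → ℕ) → ∑ (xs ++ ys) f ≡ ∑ xs f + ∑ ys f
∑-++ xs ys f = trans (cong sum (map-++ f xs ys)) (sum-++ (map f xs) (map f ys))

∑-map : ∀ (g : A → B) xs (f : B → ℕ) → ∑ (map g xs) f ≡ ∑[ x ← xs ] f (g x)
∑-map g xs f = cong sum (sym (map-∘ xs))

∑-concatMap : ∀ (g : A → List B) xs (f : B → ℕ) → ∑ (concatMap g xs) f ≡ ∑[ x ← xs ] ∑ (g x) f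
∑-concatMap g []       f = refl
∑-concatMap g (x ∷ xs) f =
  trans (∑-++ (g x) (concatMap g xs) f) (cong (∑ (g x) f +_) (∑-concatMap g xs f))

∑-cong : ∀ {f g : A → ℕ} → f ≗ g → ∀ xs → ∑ xs f ≡ ∑ xs g
∑-cong f≗g xs = cong sum (map-cong f≗g xs)

∑-*ˡ : ∀ k xs (f : A → ℕ) → ∑[ x ← xs ] k * f x ≡ k * ∑ xs f
∑-*ˡ k []       f = sym (*-zeroʳ k)
∑-*ˡ k (x ∷ xs) f = trans (cong (k * f x +_) (∑-*ˡ k xs f)) (sym (*-distribˡ-+ k (f x) _))

∑-*ʳ : ∀ k xs (f : A → ℕ) → ∑[ x ← xs ] f x * k ≡ ∑ xs f * k
∑-*ʳ k xs f = trans (∑-cong (λ x → *-comm (f x) k) xs) (trans (∑-*ˡ k xs f) (*-comm k _))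

∑-upTo-suc : ∀ n (f : ℕ → ℕ) → ∑ (upTo (suc n)) f ≡ ∑ (upTo n) f + f n
∑-upTo-suc n f = begin
  ∑ (upTo (suc n)) f        ≡⟨ cong (λ xs → ∑ xs f) (sym (upTo-∷ʳ n)) ⟩
  ∑ (upTo n ++ (n ∷ [])) f  ≡⟨ ∑-++ (upTo n) (n ∷ []) f ⟩
  ∑ (upTo n) f + (f n + 0)  ≡⟨ cong (∑ (upTo n) f +_) (+-identityʳ (f n)) ⟩
  ∑ (upTo n) f + f n        ∎
  where open ≡-Reasoning

module _ {ℓ : Level} {P : Pred B ℓ} (P? : Decidable P) where

  filter-map : ∀ (f : A → B) xs → filter P? (map f xs) ≡ map f (filter (P? ∘ f) xs)
  filter-map f []       = refl
  filter-map f (x ∷ xs) with does (P? (f x))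
  ... | true  = cong (f x ∷_) (filter-map f xs)
  ... | false = filter-map f xs

  filter-concatMap : ∀ (g : A → List B) xs → filter P? (concatMap g xs) ≡ concatMap (filter P? ∘ g) xs
  filter-concatMap g []       = refl
  filter-concatMap g (x ∷ xs) =
    trans (filter-++ P? (g x) (concatMap g xs)) (cong (filter P? (g x) ++_) (filter-concatMap g xs))

concatMap-cong-local : ∀ {f g : A → List B} {xs} → All (λ x → f x ≡ g x) xs → concatMap f xs ≡ concatMap g xs
concatMap-cong-local f≡g = cong concat (map-cong-local f≡g)

range1-suc : ∀ m → range1 (suc m) ≡ range1 m ++ (suc m ∷ [])
range1-suc m = trans (cong (map suc) (sym (upTo-∷ʳ m))) (map-++ suc (upTo m) (m ∷ []))

all-range1 : ∀ m → All (_≤ m) (range1 m)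
all-range1 m = map⁺ (all-upTo m)

filter-≤ᵇ-range1 : ∀ {c m} → c ≤′ m → filterᵇ (_≤ᵇ c) (range1 m) ≡ range1 c
filter-≤ᵇ-range1 {c} ≤′-refl = filter-all (T? ∘ (_≤ᵇ c)) (All.map ≤⇒≤ᵇ (all-range1 c))
filter-≤ᵇ-range1 {c} {suc m} (≤′-step c≤′m) = begin
  filterᵇ (_≤ᵇ c) (range1 (suc m))
    ≡⟨ cong (filterᵇ (_≤ᵇ c)) (range1-suc m) ⟩
  filterᵇ (_≤ᵇ c) (range1 m ++ (suc m ∷ []))
    ≡⟨ filter-++ (T? ∘ (_≤ᵇ c)) (range1 m) _ ⟩
  filterᵇ (_≤ᵇ c) (range1 m) ++ filterᵇ (_≤ᵇ c) (suc m ∷ [])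
    ≡⟨ cong₂ _++_ (filter-≤ᵇ-range1 c≤′m) (filter-reject (T? ∘ (_≤ᵇ c)) 1+m≰c) ⟩
  range1 c ++ []
    ≡⟨ ++-identityʳ (range1 c) ⟩
  range1 c
    ∎
  where
  open ≡-Reasoning
  1+m≰c : ¬ T (suc m ≤ᵇ c)
  1+m≰c 1+m≤c = <⇒≱ (s≤s (≤′⇒≤ c≤′m)) (≤ᵇ⇒≤ (suc m) c 1+m≤c)

blockB-c≥d≡ : ∀ n → blockB-c≥d n ≡
  concatMap (λ i → concatMap (λ a → concatMap (λ c → map (λ d → (a , suc i , c , d)) (range1 c)) (range1 i)) (range1 i)) (range1 n)
blockB-c≥d≡ n = trans (filter-concatMap c≥d? _ (range1 n)) (concatMap-cong filter-slab (range1 n))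
  where
  label : ℕ → ℕ → ℕ → ℕ → Label
  label a i c d = (a , suc i , c , d)

  d≤ᵇc : Label → Bool
  d≤ᵇc (_ , _ , c , d) = d ≤ᵇ c

  c≥d? : Decidable (T ∘ d≤ᵇc)
  c≥d? = T? ∘ d≤ᵇc

  filter-column : ∀ {i a c} → c ≤ i → filter c≥d? (map (label a i c) (range1 i)) ≡ map (label a i c) (range1 c)
  filter-column {i} {a} {c} c≤i =
    trans (filter-map c≥d? (label a i c) (range1 i)) (cong (map (label a i c)) (filter-≤ᵇ-range1 (≤⇒≤′ c≤i)))

  filter-layer : ∀ i a → filter c≥d? (concatMap (λ c → map (label a i c) (range1 i)) (range1 i))
                       ≡ concatMap (λ c → map (label a i c) (range1 c)) (range1 i)
  filter-layer i a =
    trans (filter-concatMap c≥d? _ (range1 i)) (concatMap-cong-local (All.map filter-column (all-range1 i)))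

  filter-slab : ∀ i → filter c≥d? (concatMap (λ a → concatMap (λ c → map (label a i c) (range1 i)) (range1 i)) (range1 i))
                    ≡ concatMap (λ a → concatMap (λ c → map (label a i c) (range1 c)) (range1 i)) (range1 i)
  filter-slab i = trans (filter-concatMap c≥d? _ (range1 i)) (concatMap-cong (filter-layer i) (range1 i))

∑-concatMap-range1 : ∀ (g : ℕ → List A) n (f : A → ℕ) → ∑ (concatMap g (range1 n)) f ≡ ∑[ j ← upTo n ] ∑ (g (suc j)) f
∑-concatMap-range1 g n f = trans (∑-concatMap g (range1 n) f) (∑-map suc (upTo n) (λ i → ∑ (g i) f))

∑-blockB-c≥d : ∀ n (f : Label → ℕ) → ∑ (blockB-c≥d n) f ≡
  ∑[ j ← upTo n ] ∑[ a ← upTo (suc j) ] ∑[ c ← upTo (suc j) ] ∑[ d ← upTo (suc c) ] f (suc a , suc (suc j) , suc c , suc d)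
∑-blockB-c≥d n f = begin
  ∑ (blockB-c≥d n) f                   ≡⟨ cong (λ xs → ∑ xs f) (blockB-c≥d≡ n) ⟩
  ∑ (concatMap slab (range1 n)) f      ≡⟨ ∑-concatMap-range1 slab n f ⟩
  ∑[ j ← upTo n ] ∑ (slab (suc j)) f   ≡⟨ ∑-cong (∑-slab ∘ suc) (upTo n) ⟩
  ∑[ j ← upTo n ] ∑[ a ← upTo (suc j) ] ∑[ c ← upTo (suc j) ] ∑[ d ← upTo (suc c) ] f (suc a , suc (suc j) , suc c , suc d) ∎
  where
  open ≡-Reasoning

  column : ℕ → ℕ → ℕ → List Label
  column i a c = map (λ d → (a , suc i , c , d)) (range1 c)

  layer : ℕ → ℕ → List Label
  layer i a = concatMap (column i a) (range1 i)

  slab : ℕ → List Label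
  slab i = concatMap (layer i) (range1 i)

  ∑-column : ∀ i a c → ∑ (column i a (suc c)) f ≡ ∑[ d ← upTo (suc c) ] f (a , suc i , suc c , suc d)
  ∑-column i a c = trans (∑-map _ (range1 (suc c)) f) (∑-map suc (upTo (suc c)) _)

  ∑-layer : ∀ i a → ∑ (layer i a) f ≡ ∑[ c ← upTo i ] ∑[ d ← upTo (suc c) ] f (a , suc i , suc c , suc d)
  ∑-layer i a = trans (∑-concatMap-range1 (column i a) i f) (∑-cong (∑-column i a) (upTo i))

  ∑-slab : ∀ i → ∑ (slab i) f ≡ ∑[ a ← upTo i ] ∑[ c ← upTo i ] ∑[ d ← upTo (suc c) ] f (suc a , suc i , suc c , suc d)
  ∑-slab i = trans (∑-concatMap-range1 (layer i) i f) (∑-cong (∑-layer i ∘ suc) (upTo i))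

[1+k]≡[k]+q^k : ∀ k q → [ suc k ] q ≡ [ k ] q + q ^ k
[1+k]≡[k]+q^k k q = ∑-upTo-suc k (q ^_)

-- The sum of q ^ (c + d) over 0 ≤ d ≤ c < m: a q-analogue of the triangular number m (m + 1) / 2.
triangular : ℕ → ℕ → ℕ
triangular q m = ∑[ c ← upTo m ] q ^ c * [ suc c ] q

[1+q]*triangular≡[1+m]*[m] : ∀ q m → suc q * triangular q m ≡ [ suc m ] q * [ m ] q
[1+q]*triangular≡[1+m]*[m] q 0       = *-zeroʳ (suc q)
[1+q]*triangular≡[1+m]*[m] q (suc m) = begin
  suc q * triangular q (suc m)
    ≡⟨ cong (suc q *_) (∑-upTo-suc m _) ⟩
  suc q * (triangular q m + q ^ m * [ suc m ] q)
    ≡⟨ *-distribˡ-+ (suc q) (triangular q m) _ ⟩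
  suc q * triangular q m + suc q * (q ^ m * [ suc m ] q)
    ≡⟨ cong (_+ suc q * (q ^ m * [ suc m ] q)) ([1+q]*triangular≡[1+m]*[m] q m) ⟩
  [ suc m ] q * [ m ] q + suc q * (q ^ m * [ suc m ] q)
    ≡⟨ factor-out ([ suc m ] q) ([ m ] q) (q ^ m) ⟩
  ([ m ] q + q ^ m + q * q ^ m) * [ suc m ] q
    ≡⟨ cong (λ x → (x + q ^ suc m) * [ suc m ] q) ([1+k]≡[k]+q^k m q) ⟨
  ([ suc m ] q + q ^ suc m) * [ suc m ] q
    ≡⟨ cong (_* [ suc m ] q) ([1+k]≡[k]+q^k (suc m) q) ⟨
  [ suc (suc m) ] q * [ suc m ] q
    ∎
  where
  open ≡-Reasoning
  open +-*-Solver
  factor-out : ∀ x y z → x * y + suc q * (z * x) ≡ (y + z + q * z) * x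
  factor-out x y z = solve 4 (λ x y z q → x :* y :+ (con 1 :+ q) :* (z :* x) := (y :+ z :+ q :* z) :* x) refl x y z q

triangular≡[1+m]*[m]/[1+q] : ∀ q m → triangular q m ≡ ([ suc m ] q * [ m ] q) / suc q
triangular≡[1+m]*[m]/[1+q] q m = begin
  triangular q m                  ≡⟨ m*n/n≡m (triangular q m) (suc q) ⟨
  triangular q m * suc q / suc q  ≡⟨ cong (_/ suc q) (*-comm (triangular q m) (suc q)) ⟩
  suc q * triangular q m / suc q  ≡⟨ cong (_/ suc q) ([1+q]*triangular≡[1+m]*[m] q m) ⟩
  [ suc m ] q * [ m ] q / suc q   ∎
  where open ≡-Reasoning

q^[a+j+c+d] : ∀ q a j c d → q ^ (a + j + c + d) ≡ q ^ a * q ^ j * (q ^ c * q ^ d)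
q^[a+j+c+d] q a j c d = begin
  q ^ (a + j + c + d)               ≡⟨ cong (q ^_) (+-assoc (a + j) c d) ⟩
  q ^ (a + j + (c + d))             ≡⟨ ^-distribˡ-+-* q (a + j) (c + d) ⟩
  q ^ (a + j) * q ^ (c + d)         ≡⟨ cong₂ _*_ (^-distribˡ-+-* q a j) (^-distribˡ-+-* q c d) ⟩
  q ^ a * q ^ j * (q ^ c * q ^ d)   ∎
  where open ≡-Reasoning

∑-prism : ∀ q j m → ∑[ a ← upTo m ] ∑[ c ← upTo m ] ∑[ d ← upTo (suc c) ] q ^ (a + j + c + d) ≡ [ m ] q * q ^ j * triangular q m
∑-prism q j m = begin
  ∑[ a ← upTo m ] ∑[ c ← upTo m ] ∑[ d ← upTo (suc c) ] q ^ (a + j + c + d)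
    ≡⟨ ∑-cong (λ a → ∑-cong (λ c → ∑-cong (q^[a+j+c+d] q a j c) (upTo (suc c))) (upTo m)) (upTo m) ⟩
  ∑[ a ← upTo m ] ∑[ c ← upTo m ] ∑[ d ← upTo (suc c) ] q ^ a * q ^ j * (q ^ c * q ^ d)
    ≡⟨ ∑-cong (λ a → ∑-cong (∑-column a) (upTo m)) (upTo m) ⟩
  ∑[ a ← upTo m ] ∑[ c ← upTo m ] q ^ a * q ^ j * (q ^ c * [ suc c ] q)
    ≡⟨ ∑-cong (λ a → trans (∑-*ˡ (q ^ a * q ^ j) (upTo m) _) (*-assoc (q ^ a) (q ^ j) _)) (upTo m) ⟩
  ∑[ a ← upTo m ] q ^ a * (q ^ j * triangular q m)
    ≡⟨ ∑-*ʳ _ (upTo m) (q ^_) ⟩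
  [ m ] q * (q ^ j * triangular q m)
    ≡⟨ *-assoc ([ m ] q) (q ^ j) _ ⟨
  [ m ] q * q ^ j * triangular q m
    ∎
  where
  open ≡-Reasoning
  ∑-column : ∀ a c → ∑[ d ← upTo (suc c) ] q ^ a * q ^ j * (q ^ c * q ^ d) ≡ q ^ a * q ^ j * (q ^ c * [ suc c ] q)
  ∑-column a c = trans (∑-*ˡ (q ^ a * q ^ j) (upTo (suc c)) _) (cong (q ^ a * q ^ j *_) (∑-*ˡ (q ^ c) (upTo (suc c)) (q ^_)))

-- The identity holds for every n.
lemma16 : (n : ℕ) → 2 ≤ n → (q : ℕ) → lhs n q ≡ rhs n q
lemma16 n _ q = begin
  lhs n q
    ≡⟨ ∑-map suc (upTo n) _ ⟩
  ∑[ j ← upTo n ] [ suc j ] q * q ^ j * (([ suc (suc j) ] q * [ suc j ] q) / suc q)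
    ≡⟨ ∑-cong (λ j → cong ([ suc j ] q * q ^ j *_) (triangular≡[1+m]*[m]/[1+q] q (suc j))) (upTo n) ⟨
  ∑[ j ← upTo n ] [ suc j ] q * q ^ j * triangular q (suc j)
    ≡⟨ ∑-cong (λ j → ∑-prism q j (suc j)) (upTo n) ⟨
  ∑[ j ← upTo n ] ∑[ a ← upTo (suc j) ] ∑[ c ← upTo (suc j) ] ∑[ d ← upTo (suc c) ] q ^ (a + j + c + d)
    ≡⟨ ∑-blockB-c≥d n (λ l → q ^ dist l) ⟨
  rhs n q
    ∎
  where open ≡-Reasoning
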